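{- For every integer $n\ge 2$, the number of $1$-flaw preference sets $(a_1,\dots,a_n)$ with $n$ spaces and $a_1=n$ equals the number of parking functions $(a_1,\dots,a_n)$ with $n$ spaces and $a_1=2$; in the paper's notation, $p^n_{n;1}=p^2_n$.
   Context: Parking model: there are $n$ parking spaces in a line, numbered $1,\dots,n$. A preference set of length $n$ is a sequence $(a_1,\dots,a_n)$ of integers with $1\le a_i\le n$; cars $1,\dots,n$ arrive in order, car $i$ parks in the first unoccupied space numbered $\ge a_i$ if one exists, otherwise it fails to park. It is a $k$-flaw preference set if exactly $k$ cars fail to park, and a parking function if no car fails. $p^l_{n;k}$ denotes the number of $k$-flaw preference sets of length $n$ (with $n$ spaces) with $a_1=l$, and $p^l_n$ the number of parking functions of length $n$ (with $n$ spaces) with $a_1=l$. -}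

module Defs where

open import Data.Nat using (ℕ; zero; suc; _≤ᵇ_; _≡ᵇ_)
open import Data.Bool using (Bool; true; false; not; _∧_)
open import Data.List using (List; []; _∷_; length; filterᵇ; map; concatMap; upTo; replicate)
open import Data.Product using (_×_; _,_)

-- Parking lot: a list of Booleans, one per space, in order 1,…,n;
-- true = occupied.

-- parkFrom a lot: car with preference a (1-based) takes the first
-- unoccupied space whose number is ≥ a.  `pos` is the (1-based) number
-- of the head space.
parkFrom : ℕ → ℕ → List Bool → List Bool × Bool
parkFrom a pos [] = [] , false
parkFrom a pos (occ ∷ rest) with (a ≤ᵇ pos) ∧ not occ
... | true  = (true ∷ rest) , true
... | false with parkFrom a (suc pos) rest
...   | rest' , ok = (occ ∷ rest') , ok

failuresOn : List Bool → List ℕ → ℕ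
failuresOn lot [] = 0
failuresOn lot (a ∷ as) with parkFrom a 1 lot
... | lot' , true  = failuresOn lot' as
... | lot' , false = suc (failuresOn lot' as)

flaws : ℕ → List ℕ → ℕ
flaws n as = failuresOn (replicate n false) as

seqs : ℕ → ℕ → List (List ℕ)
seqs n zero    = [] ∷ []
seqs n (suc k) = concatMap (λ a → map (a ∷_) (seqs n k)) (map suc (upTo n))

headIs : ℕ → List ℕ → Bool
headIs l []      = false
headIs l (a ∷ _) = a ≡ᵇ l

prefSetsStartingWith : ℕ → ℕ → List (List ℕ)
prefSetsStartingWith n l = filterᵇ (headIs l) (seqs n n)

-- p^l_{n;k}: number of k-flaw preference sets of length n with a₁ = l.
pFlaw : ℕ → ℕ → ℕ → ℕ
pFlaw n k l = length (filterᵇ (λ s → flaws n s ≡ᵇ k) (prefSetsStartingWith n l))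

pPark : ℕ → ℕ → ℕ
pPark n l = length (filterᵇ (λ s → flaws n s ≡ᵇ 0) (prefSetsStartingWith n l))

private
  open import Relation.Binary.PropositionalEquality using (_≡_; refl)
  t1 : pFlaw 3 1 3 ≡ pPark 3 2
  t1 = refl
  t2 : pFlaw 4 1 4 ≡ pPark 4 2
  t2 = refl
  t3 : pPark 3 1 ≡ 8
  t3 = refl
  t4 : flaws 2 (2 ∷ 2 ∷ []) ≡ 1
  t4 = refl

-- A car fails exactly when a space stays empty, and a Hall-type argument shows that at most
-- t spaces stay empty iff for every j the first j spaces contain at most t more free spaces
-- than there are cars preferring one of them.
--
-- Let n = m + 1. If car 1 prefers n it takes space n, and the other m cars see spaces 1..m
-- free; if it prefers 2 they see spaces 1, 3, ..., n free. Count the continuations b with at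
-- most one flaw in the first situation in two ways. By their number of flaws, the count is
-- (flawless continuations) + p^n_{n;1}. By whether some car of b prefers space 1: if one does,
-- the Hall conditions for "at most one flaw in the first situation" and "no flaw in the
-- second" coincide, and the latter forces such a car, which gives p^2_n; if none does, then
-- b = map suc c, and b has at most one flaw iff c has none, which gives back the flawless
-- continuations, since these never use preference n.

module Submission where

open import Data.Bool using (Bool; true; false; not; _∧_; T)
open import Data.Bool.Properties using (¬-not; T-∧)
open import Data.Empty using (⊥-elim)
open import Data.List using (List; []; _∷_; length; filterᵇ; map; _++_; concatMap; applyUpTo; replicate)
open import Data.List.Properties
  using (length-++; length-map; length-filter; filter-++; filter-accept; filter-reject; filter-all; filter-complete)
open import Data.List.Relation.Unary.All as All using (All; []; _∷_)
open import Data.List.Relation.Unary.All.Properties using (all-filter)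
open import Data.Nat using (ℕ; zero; suc; pred; _+_; _⊓_; _≤_; _<_; _≤ᵇ_; _≡ᵇ_; z≤n; s≤s)
open import Data.Nat.Properties
  using (_≤?_; _<?_; ≤-refl; ≤-reflexive; ≤-trans; ≤-antisym; ≤-<-trans; ≤-pred;
         <⇒≤; <⇒≱; ≰⇒>; ≮⇒≥; <-irrefl; n≤1+n; m≤n⇒m≤1+n; m≤m+n; <⇒≤pred; ≤⇒pred≤;
         ≤⇒≤ᵇ; ≤ᵇ⇒≤; ≡ᵇ⇒≡; suc-injective;
         +-suc; +-assoc; +-comm; +-identityʳ; +-monoʳ-≤; +-cancelˡ-≤; +-cancelˡ-≡;
         m≤n⇒m⊓n≡m; m≥n⇒m⊓n≡n; ⊓-monoʳ-≤; ⊓-idem; module ≤-Reasoning)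
open import Data.Product using (_×_; _,_; proj₁; proj₂)
open import Function using (_∘_)
open import Function.Bundles using (_⇔_; mk⇔; module Equivalence)
open import Relation.Binary.PropositionalEquality
  using (_≡_; _≢_; refl; sym; trans; cong; cong₂; subst; module ≡-Reasoning)
open import Relation.Nullary using (yes; no)
open import Relation.Nullary.Decidable using (T?)

open import Defs

private
  variable
    A B : Set

countᵇ : (A → Bool) → List A → ℕ
countᵇ P xs = length (filterᵇ P xs)

module _ (P : A → Bool) where

  countᵇ-++ : ∀ xs ys → countᵇ P (xs ++ ys) ≡ countᵇ P xs + countᵇ P ys
  countᵇ-++ xs ys = trans (cong length (filter-++ _ xs ys)) (length-++ (filterᵇ P xs))

  countᵇ-map : ∀ (f : B → A) xs → countᵇ P (map f xs) ≡ countᵇ (λ x → P (f x)) xs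
  countᵇ-map f [] = refl
  countᵇ-map f (x ∷ xs) with P (f x)
  ... | true  = cong suc (countᵇ-map f xs)
  ... | false = countᵇ-map f xs

countᵇ-cong : ∀ {P Q : A → Bool} xs → (∀ x → P x ≡ Q x) → countᵇ P xs ≡ countᵇ Q xs
countᵇ-cong [] eq = refl
countᵇ-cong {P = P} {Q} (x ∷ xs) eq with P x | Q x | eq x
... | true  | true  | refl = cong suc (countᵇ-cong xs eq)
... | false | false | refl = countᵇ-cong xs eq

countᵇ-none : ∀ {P : A → Bool} xs → (∀ x → P x ≡ false) → countᵇ P xs ≡ 0
countᵇ-none [] none = refl
countᵇ-none {P = P} (x ∷ xs) none with P x | none x
... | false | refl = countᵇ-none xs none

countᵇ-filterᵇ : ∀ (P Q : A → Bool) xs → countᵇ P (filterᵇ Q xs) ≡ countᵇ (λ x → Q x ∧ P x) xs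
countᵇ-filterᵇ P Q [] = refl
countᵇ-filterᵇ P Q (x ∷ xs) with Q x
... | false = countᵇ-filterᵇ P Q xs
... | true with P x
...   | true  = cong suc (countᵇ-filterᵇ P Q xs)
...   | false = countᵇ-filterᵇ P Q xs

countᵇ-split : ∀ (Q P : A → Bool) xs →
               countᵇ P xs ≡ countᵇ (λ x → Q x ∧ P x) xs + countᵇ (λ x → not (Q x) ∧ P x) xs
countᵇ-split Q P [] = refl
countᵇ-split Q P (x ∷ xs) with Q x | P x
... | true  | true  = cong suc (countᵇ-split Q P xs)
... | false | true  = trans (cong suc (countᵇ-split Q P xs)) (sym (+-suc _ _))
... | true  | false = countᵇ-split Q P xs
... | false | false = countᵇ-split Q P xs

countᵇ-mono : ∀ {P Q : A → Bool} xs → (∀ x → T (P x) → T (Q x)) → countᵇ P xs ≤ countᵇ Q xs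
countᵇ-mono [] imp = z≤n
countᵇ-mono {P = P} {Q} (x ∷ xs) imp with P x | Q x | imp x
... | true  | true  | _ = s≤s (countᵇ-mono xs imp)
... | false | true  | _ = m≤n⇒m≤1+n (countᵇ-mono xs imp)
... | false | false | _ = countᵇ-mono xs imp
... | true  | false | imp-x = ⊥-elim (imp-x _)

countᵇ-∷-≤ : ∀ (P : A → Bool) x xs → countᵇ P xs ≤ countᵇ P (x ∷ xs)
countᵇ-∷-≤ P x xs with P x
... | true  = n≤1+n _
... | false = ≤-refl

addIfFree : Bool → ℕ → ℕ
addIfFree true  x = x
addIfFree false x = suc x

freeUpTo : ℕ → List Bool → ℕ
freeUpTo zero    L       = 0
freeUpTo (suc j) []      = 0
freeUpTo (suc j) (o ∷ L) = addIfFree o (freeUpTo j L)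

freeTotal : List Bool → ℕ
freeTotal []      = 0
freeTotal (o ∷ L) = addIfFree o (freeTotal L)

freeUpTo-[] : ∀ j → freeUpTo j [] ≡ 0
freeUpTo-[] zero    = refl
freeUpTo-[] (suc j) = refl

addIfFree-suc : ∀ o x → suc (addIfFree o x) ≡ addIfFree o (suc x)
addIfFree-suc true  x = refl
addIfFree-suc false x = refl

freeUpTo≤freeTotal : ∀ j L → freeUpTo j L ≤ freeTotal L
freeUpTo≤freeTotal zero    L       = z≤n
freeUpTo≤freeTotal (suc j) []      = z≤n
freeUpTo≤freeTotal (suc j) (true ∷ L)  = freeUpTo≤freeTotal j L
freeUpTo≤freeTotal (suc j) (false ∷ L) = s≤s (freeUpTo≤freeTotal j L)

freeUpTo-length : ∀ L → freeUpTo (length L) L ≡ freeTotal L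
freeUpTo-length []      = refl
freeUpTo-length (o ∷ L) = cong (addIfFree o) (freeUpTo-length L)

prefsUpTo : ℕ → List ℕ → ℕ
prefsUpTo j = countᵇ (_≤ᵇ j)

prefsUpTo-accept : ∀ {a j} b → a ≤ j → prefsUpTo j (a ∷ b) ≡ suc (prefsUpTo j b)
prefsUpTo-accept {a} {j} b a≤j = cong length (filter-accept (T? ∘ (_≤ᵇ j)) {a} {b} (≤⇒≤ᵇ a≤j))

prefsUpTo-reject : ∀ {a j} b → j < a → prefsUpTo j (a ∷ b) ≡ prefsUpTo j b
prefsUpTo-reject {a} {j} b j<a =
  cong length (filter-reject (T? ∘ (_≤ᵇ j)) {a} {b} (λ a≤ᵇj → <⇒≱ j<a (≤ᵇ⇒≤ a j a≤ᵇj)))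

prefsUpTo-mono : ∀ b {i j} → i ≤ j → prefsUpTo i b ≤ prefsUpTo j b
prefsUpTo-mono b {i} i≤j =
  countᵇ-mono b (λ a a≤ᵇi → ≤⇒≤ᵇ (≤-trans (≤ᵇ⇒≤ a i a≤ᵇi) i≤j))

prefsUpTo≤length : ∀ j b → prefsUpTo j b ≤ length b
prefsUpTo≤length j = length-filter (T? ∘ (_≤ᵇ j))

prefsUpTo-bounded : ∀ {n j b} → All (_≤ n) b → n ≤ j → prefsUpTo j b ≡ length b
prefsUpTo-bounded {n} {j} bounded n≤j =
  cong length (filter-all (T? ∘ (_≤ᵇ j)) (All.map (λ a≤n → ≤⇒≤ᵇ (≤-trans a≤n n≤j)) bounded))

prefsUpTo≡length⇒bounded : ∀ {j} b → prefsUpTo j b ≡ length b → All (_≤ j) b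
prefsUpTo≡length⇒bounded {j} b all-counted =
  All.map (≤ᵇ⇒≤ _ j)
    (subst (All _) (filter-complete (T? ∘ (_≤ᵇ j)) all-counted) (all-filter (T? ∘ (_≤ᵇ j)) b))

≤ᵇ-suc : ∀ a p → (suc a ≤ᵇ suc p) ≡ (a ≤ᵇ p)
≤ᵇ-suc zero    p = refl
≤ᵇ-suc (suc a) p = refl

prefsUpTo-map-suc : ∀ j c → prefsUpTo (suc j) (map suc c) ≡ prefsUpTo j c
prefsUpTo-map-suc j c = trans (countᵇ-map (_≤ᵇ suc j) suc c) (countᵇ-cong c (λ a → ≤ᵇ-suc a j))

parkFrom-suc : ∀ a p L → parkFrom (suc a) (suc p) L ≡ parkFrom a p L
parkFrom-suc a p [] = refl
parkFrom-suc a p (o ∷ L) rewrite ≤ᵇ-suc a p with (a ≤ᵇ p) ∧ not o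
... | true  = refl
... | false rewrite parkFrom-suc a (suc p) L = refl

parkFrom-0≡1 : ∀ p L → parkFrom 0 (suc p) L ≡ parkFrom 1 (suc p) L
parkFrom-0≡1 p []           = refl
parkFrom-0≡1 p (false ∷ L) = refl
parkFrom-0≡1 p (true ∷ L) rewrite parkFrom-0≡1 (suc p) L = refl

-- A car skipping the first d spaces either takes a space s > d, the spaces d+1, ..., s-1
-- being occupied, or finds every space after d occupied.
data ParkSpec (d : ℕ) (L : List Bool) : List Bool × Bool → Set where
  parks : ∀ {L'} s → d < s
        → (∀ j → j < s → freeUpTo j L' ≡ freeUpTo j L)
        → (∀ j → s ≤ j → suc (freeUpTo j L') ≡ freeUpTo j L)
        → (∀ j → d ≤ j → j < s → freeUpTo j L ≡ freeUpTo d L)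
        → suc (freeTotal L') ≡ freeTotal L
        → ParkSpec d L (L' , true)
  fails : (∀ j → d ≤ j → freeUpTo j L ≡ freeUpTo d L) → ParkSpec d L (L , false)

parkSpec-∷ : ∀ {d L} o r → ParkSpec d L r → ParkSpec (suc d) (o ∷ L) (o ∷ proj₁ r , proj₂ r)
parkSpec-∷ {d} {L} o (L' , _) (parks s d<s below above between total) =
  parks (suc s) (s≤s d<s) below′ above′ between′ (trans (addIfFree-suc o _) (cong (addIfFree o) total))
  where
  below′ : ∀ j → j < suc s → freeUpTo j (o ∷ L') ≡ freeUpTo j (o ∷ L)
  below′ zero    _         = refl
  below′ (suc j) (s≤s j<s) = cong (addIfFree o) (below j j<s)
  above′ : ∀ j → suc s ≤ j → suc (freeUpTo j (o ∷ L')) ≡ freeUpTo j (o ∷ L)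
  above′ (suc j) (s≤s s≤j) = trans (addIfFree-suc o _) (cong (addIfFree o) (above j s≤j))
  between′ : ∀ j → suc d ≤ j → j < suc s → freeUpTo j (o ∷ L) ≡ freeUpTo (suc d) (o ∷ L)
  between′ (suc j) (s≤s d≤j) (s≤s j<s) = cong (addIfFree o) (between j d≤j j<s)
parkSpec-∷ {d} {L} o _ (fails occupied) = fails occupied′
  where
  occupied′ : ∀ j → suc d ≤ j → freeUpTo j (o ∷ L) ≡ freeUpTo (suc d) (o ∷ L)
  occupied′ (suc j) (s≤s d≤j) = cong (addIfFree o) (occupied j d≤j)

parkSpec-occupied : ∀ {L r} → ParkSpec 1 (true ∷ L) r → ParkSpec 0 (true ∷ L) r
parkSpec-occupied {L} (parks s (s≤s _) below above between total) =
  parks s (s≤s z≤n) below above between′ total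
  where
  between′ : ∀ j → 0 ≤ j → j < s → freeUpTo j (true ∷ L) ≡ 0
  between′ zero    _ _   = refl
  between′ (suc j) _ j<s = between (suc j) (s≤s z≤n) j<s
parkSpec-occupied {L} (fails occupied) = fails occupied′
  where
  occupied′ : ∀ j → 0 ≤ j → freeUpTo j (true ∷ L) ≡ 0
  occupied′ zero    _ = refl
  occupied′ (suc j) _ = occupied (suc j) (s≤s z≤n)

parkSpec : ∀ d L → ParkSpec d L (parkFrom (suc d) 1 L)
parkSpec d [] = fails (λ j _ → trans (freeUpTo-[] j) (sym (freeUpTo-[] d)))
parkSpec zero (false ∷ L) = parks 1 (s≤s z≤n) below above between refl
  where
  below : ∀ j → j < 1 → freeUpTo j (true ∷ L) ≡ freeUpTo j (false ∷ L)
  below zero    _ = refl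
  below (suc j) (s≤s ())
  above : ∀ j → 1 ≤ j → suc (freeUpTo j (true ∷ L)) ≡ freeUpTo j (false ∷ L)
  above (suc j) _ = refl
  between : ∀ j → 0 ≤ j → j < 1 → freeUpTo j (false ∷ L) ≡ 0
  between zero    _ _ = refl
  between (suc j) _ (s≤s ())
parkSpec zero (true ∷ L)
  rewrite parkFrom-suc 0 1 L | parkFrom-0≡1 0 L = parkSpec-occupied (parkSpec-∷ true _ (parkSpec 0 L))
parkSpec (suc d) (o ∷ L) rewrite parkFrom-suc (suc d) 1 L = parkSpec-∷ o _ (parkSpec d L)

parkFrom-spec : ∀ a L → ParkSpec (pred a) L (parkFrom a 1 L)
parkFrom-spec zero    L = subst (ParkSpec 0 L) (sym (parkFrom-0≡1 0 L)) (parkSpec 0 L)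
parkFrom-spec (suc d) L = parkSpec d L

DeficitAtMost : ℕ → List Bool → List ℕ → Set
DeficitAtMost t L b = ∀ j → freeUpTo j L ≤ t + prefsUpTo j b

deficit-∷-below : ∀ {t L a b} → DeficitAtMost t L (a ∷ b) →
                  ∀ j → j < a → freeUpTo j L ≤ t + prefsUpTo j b
deficit-∷-below {t} {L} {a} {b} deficit j j<a = begin
  freeUpTo j L              ≤⟨ deficit j ⟩
  t + prefsUpTo j (a ∷ b)   ≡⟨ cong (t +_) (prefsUpTo-reject b j<a) ⟩
  t + prefsUpTo j b         ∎
  where open ≤-Reasoning

deficit-∷-skipped : ∀ {t L} a {b} → DeficitAtMost t L (a ∷ b) →
                    ∀ j → a ≤ j → freeUpTo (pred a) L ≤ t + prefsUpTo j b
deficit-∷-skipped zero    _       _ _   = z≤n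
deficit-∷-skipped {t} {L} (suc d) {b} deficit j a≤j = begin
  freeUpTo d L        ≤⟨ deficit-∷-below {t} {L} {suc d} {b} deficit d ≤-refl ⟩
  t + prefsUpTo d b   ≤⟨ +-monoʳ-≤ t (prefsUpTo-mono b (≤-trans (n≤1+n d) a≤j)) ⟩
  t + prefsUpTo j b   ∎
  where open ≤-Reasoning

deficit-park⇒ : ∀ {t L L' a b} → ParkSpec (pred a) L (L' , true) →
                DeficitAtMost t L (a ∷ b) → DeficitAtMost t L' b
deficit-park⇒ {t} {L} {L'} {a} {b} (parks s d<s below above between _) deficit j with a ≤? j
... | no j≮a = begin
  freeUpTo j L'      ≡⟨ below j (≤-<-trans (<⇒≤pred (≰⇒> j≮a)) d<s) ⟩
  freeUpTo j L       ≤⟨ deficit-∷-below {t} {L} {a} {b} deficit j (≰⇒> j≮a) ⟩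
  t + prefsUpTo j b  ∎
  where open ≤-Reasoning
... | yes a≤j with j <? s
...   | yes j<s = begin
  freeUpTo j L'         ≡⟨ below j j<s ⟩
  freeUpTo j L          ≡⟨ between j (≤⇒pred≤ a≤j) j<s ⟩
  freeUpTo (pred a) L   ≤⟨ deficit-∷-skipped {t} {L} a {b} deficit j a≤j ⟩
  t + prefsUpTo j b     ∎
  where open ≤-Reasoning
...   | no j≮s = ≤-pred (begin
  suc (freeUpTo j L')       ≡⟨ above j (≮⇒≥ j≮s) ⟩
  freeUpTo j L              ≤⟨ deficit j ⟩
  t + prefsUpTo j (a ∷ b)   ≡⟨ cong (t +_) (prefsUpTo-accept b a≤j) ⟩
  t + suc (prefsUpTo j b)   ≡⟨ +-suc t _ ⟩
  suc (t + prefsUpTo j b)   ∎)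
  where open ≤-Reasoning

deficit-park⇐ : ∀ {t L L' a b} → ParkSpec (pred a) L (L' , true) →
                DeficitAtMost t L' b → DeficitAtMost t L (a ∷ b)
deficit-park⇐ {t} {L} {L'} {a} {b} (parks s d<s below above _ _) deficit j with a ≤? j
... | no j≮a = begin
  freeUpTo j L              ≡⟨ below j (≤-<-trans (<⇒≤pred (≰⇒> j≮a)) d<s) ⟨
  freeUpTo j L'             ≤⟨ deficit j ⟩
  t + prefsUpTo j b         ≡⟨ cong (t +_) (prefsUpTo-reject b (≰⇒> j≮a)) ⟨
  t + prefsUpTo j (a ∷ b)   ∎
  where open ≤-Reasoning
... | yes a≤j = begin
  freeUpTo j L              ≤⟨ at-most-one-more ⟩
  suc (freeUpTo j L')       ≤⟨ s≤s (deficit j) ⟩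
  suc (t + prefsUpTo j b)   ≡⟨ +-suc t _ ⟨
  t + suc (prefsUpTo j b)   ≡⟨ cong (t +_) (prefsUpTo-accept b a≤j) ⟨
  t + prefsUpTo j (a ∷ b)   ∎
  where
  open ≤-Reasoning
  at-most-one-more : freeUpTo j L ≤ suc (freeUpTo j L')
  at-most-one-more with j <? s
  ... | yes j<s = ≤-trans (≤-reflexive (sym (below j j<s))) (n≤1+n _)
  ... | no j≮s  = ≤-reflexive (sym (above j (≮⇒≥ j≮s)))

deficit-fail⇒ : ∀ {t L a b} → ParkSpec (pred a) L (L , false) →
                DeficitAtMost t L (a ∷ b) → DeficitAtMost t L b
deficit-fail⇒ {t} {L} {a} {b} (fails occupied) deficit j with a ≤? j
... | no j≮a  = deficit-∷-below {t} {L} {a} {b} deficit j (≰⇒> j≮a)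
... | yes a≤j = begin
  freeUpTo j L          ≡⟨ occupied j (≤⇒pred≤ a≤j) ⟩
  freeUpTo (pred a) L   ≤⟨ deficit-∷-skipped {t} {L} a {b} deficit j a≤j ⟩
  t + prefsUpTo j b     ∎
  where open ≤-Reasoning

deficit-fail⇐ : ∀ {t L a b} → DeficitAtMost t L b → DeficitAtMost t L (a ∷ b)
deficit-fail⇐ {t} {L} {a} {b} deficit j = ≤-trans (deficit j) (+-monoʳ-≤ t (countᵇ-∷-≤ (_≤ᵇ j) a b))

-- Every car parks or fails, so this bound says that at most t free spaces remain empty.
deficit⇒failures : ∀ L b t → DeficitAtMost t L b → freeTotal L + failuresOn L b ≤ length b + t
deficit⇒failures L [] t deficit = begin
  freeTotal L + 0              ≡⟨ +-identityʳ _ ⟩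
  freeTotal L                  ≡⟨ freeUpTo-length L ⟨
  freeUpTo (length L) L        ≤⟨ deficit (length L) ⟩
  t + 0                        ≡⟨ +-identityʳ t ⟩
  t                            ∎
  where open ≤-Reasoning
deficit⇒failures L (a ∷ b) t deficit with parkFrom a 1 L | parkFrom-spec a L
... | _ | spec@(parks _ _ _ _ _ total) =
  subst (λ F → F + _ ≤ suc (length b + t)) total
        (s≤s (deficit⇒failures _ b t (deficit-park⇒ {t} {L} {_} {a} {b} spec deficit)))
... | _ | spec@(fails _) =
  subst (_≤ suc (length b + t)) (sym (+-suc _ _))
        (s≤s (deficit⇒failures L b t (deficit-fail⇒ {t} {L} {a} {b} spec deficit)))

failures⇒deficit : ∀ L b t → freeTotal L + failuresOn L b ≤ length b + t → DeficitAtMost t L b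
failures⇒deficit L [] t bound j = begin
  freeUpTo j L       ≤⟨ freeUpTo≤freeTotal j L ⟩
  freeTotal L        ≤⟨ m≤m+n _ _ ⟩
  freeTotal L + 0    ≤⟨ bound ⟩
  t                  ≡⟨ +-identityʳ t ⟨
  t + 0              ∎
  where open ≤-Reasoning
failures⇒deficit L (a ∷ b) t bound with parkFrom a 1 L | parkFrom-spec a L
... | _ | spec@(parks _ _ _ _ _ total) =
  deficit-park⇐ {t} {L} {_} {a} {b} spec
    (failures⇒deficit _ b t (≤-pred (subst (λ F → F + _ ≤ suc (length b + t)) (sym total) bound)))
... | _ | spec@(fails _) =
  deficit-fail⇐ {t} {L} {a} {b}
    (failures⇒deficit L b t (≤-pred (subst (_≤ suc (length b + t)) (+-suc _ _) bound)))

failures≤⇔deficit : ∀ L b t → freeTotal L ≡ length b → failuresOn L b ≤ t ⇔ DeficitAtMost t L b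
failures≤⇔deficit L b t free≡cars = mk⇔
  (λ f≤t → failures⇒deficit L b t (subst (λ F → F + failuresOn L b ≤ length b + t) (sym free≡cars)
                                           (+-monoʳ-≤ (length b) f≤t)))
  (λ deficit → +-cancelˡ-≤ (length b) _ _ (subst (λ F → F + failuresOn L b ≤ length b + t) free≡cars
                                                 (deficit⇒failures L b t deficit)))

T-⇔⇒≡ : ∀ {x y} → T x ⇔ T y → x ≡ y
T-⇔⇒≡ {true}  {true}  _   = refl
T-⇔⇒≡ {true}  {false} x⇔y = ⊥-elim (Equivalence.to x⇔y _)
T-⇔⇒≡ {false} {true}  x⇔y = ⊥-elim (Equivalence.from x⇔y _)
T-⇔⇒≡ {false} {false} _   = refl

T-failures≤ᵇ⇔deficit : ∀ L b t → freeTotal L ≡ length b →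
                       T (failuresOn L b ≤ᵇ t) ⇔ DeficitAtMost t L b
T-failures≤ᵇ⇔deficit L b t free≡cars = mk⇔ (to ∘ ≤ᵇ⇒≤ _ t) (≤⇒≤ᵇ ∘ from)
  where open Equivalence (failures≤⇔deficit L b t free≡cars)

sumBelow : ℕ → (ℕ → ℕ) → ℕ
sumBelow zero    h = 0
sumBelow (suc n) h = h 0 + sumBelow n (h ∘ suc)

sumBelow-cong : ∀ n {h h′} → (∀ i → i < n → h i ≡ h′ i) → sumBelow n h ≡ sumBelow n h′
sumBelow-cong zero    eq = refl
sumBelow-cong (suc n) eq = cong₂ _+_ (eq 0 (s≤s z≤n)) (sumBelow-cong n (λ i i<n → eq (suc i) (s≤s i<n)))

sumBelow-zero : ∀ n {h} → (∀ i → h i ≡ 0) → sumBelow n h ≡ 0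
sumBelow-zero zero    vanish = refl
sumBelow-zero (suc n) vanish = cong₂ _+_ (vanish 0) (sumBelow-zero n (vanish ∘ suc))

sumBelow-last : ∀ n h → sumBelow (suc n) h ≡ sumBelow n h + h n
sumBelow-last zero    h = +-comm (h 0) 0
sumBelow-last (suc n) h = trans (cong (h 0 +_) (sumBelow-last n (h ∘ suc))) (sym (+-assoc (h 0) _ _))

sumBelow-single : ∀ {n h} l → l < n → (∀ i → i ≢ l → h i ≡ 0) → sumBelow n h ≡ h l
sumBelow-single {suc n} {h} zero _ vanish =
  trans (cong (h 0 +_) (sumBelow-zero n (λ i → vanish (suc i) λ ()))) (+-identityʳ (h 0))
sumBelow-single {suc n} {h} (suc l) (s≤s l<n) vanish =
  cong₂ _+_ (vanish 0 λ ()) (sumBelow-single l l<n (λ i i≢l → vanish (suc i) (i≢l ∘ suc-injective)))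

private
  countᵇ-prefixed : ∀ (P : List ℕ → Bool) S n f →
    countᵇ P (concatMap (λ a → map (a ∷_) S) (map suc (applyUpTo f n)))
      ≡ sumBelow n (λ i → countᵇ (λ b → P (suc (f i) ∷ b)) S)
  countᵇ-prefixed P S zero    f = refl
  countᵇ-prefixed P S (suc n) f = trans (countᵇ-++ P (map (suc (f 0) ∷_) S) _)
    (cong₂ _+_ (countᵇ-map P (suc (f 0) ∷_) S) (countᵇ-prefixed P S n (f ∘ suc)))

countᵇ-seqs-suc : ∀ (P : List ℕ → Bool) n m →
  countᵇ P (seqs n (suc m)) ≡ sumBelow n (λ i → countᵇ (λ b → P (suc i ∷ b)) (seqs n m))
countᵇ-seqs-suc P n m = countᵇ-prefixed P (seqs n m) n (λ i → i)

countᵇ-seqs-cong : ∀ n m {P Q} → (∀ b → length b ≡ m → All (_≤ n) b → P b ≡ Q b) →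
                   countᵇ P (seqs n m) ≡ countᵇ Q (seqs n m)
countᵇ-seqs-cong n zero {P} {Q} eq with P [] | Q [] | eq [] refl []
... | true  | true  | refl = refl
... | false | false | refl = refl
countᵇ-seqs-cong n (suc m) {P} {Q} eq = begin
  countᵇ P (seqs n (suc m))
    ≡⟨ countᵇ-seqs-suc P n m ⟩
  sumBelow n (λ i → countᵇ (λ b → P (suc i ∷ b)) (seqs n m))
    ≡⟨ sumBelow-cong n (λ i i<n → countᵇ-seqs-cong n m
         (λ b len bounded → eq (suc i ∷ b) (cong suc len) (i<n ∷ bounded))) ⟩
  sumBelow n (λ i → countᵇ (λ b → Q (suc i ∷ b)) (seqs n m))
    ≡⟨ countᵇ-seqs-suc Q n m ⟨
  countᵇ Q (seqs n (suc m))
    ∎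
  where open ≡-Reasoning

anyPrefers1 : List ℕ → Bool
anyPrefers1 b = 1 ≤ᵇ prefsUpTo 1 b

countᵇ-seqs-without-1 : ∀ k m (P : List ℕ → Bool) →
  countᵇ (λ b → not (anyPrefers1 b) ∧ P b) (seqs (suc k) m) ≡ countᵇ (λ c → P (map suc c)) (seqs k m)
countᵇ-seqs-without-1 k zero    P with P []
... | true  = refl
... | false = refl
countᵇ-seqs-without-1 k (suc m) P = begin
  countᵇ (λ b → not (anyPrefers1 b) ∧ P b) (seqs (suc k) (suc m))
    ≡⟨ countᵇ-seqs-suc _ (suc k) m ⟩
  countᵇ (λ b → not (anyPrefers1 (1 ∷ b)) ∧ P (1 ∷ b)) (seqs (suc k) m)
    + sumBelow k (λ i → countᵇ (λ b → not (anyPrefers1 b) ∧ P (suc (suc i) ∷ b)) (seqs (suc k) m))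
    ≡⟨ cong₂ _+_ (countᵇ-none (seqs (suc k) m) (λ _ → refl))
                 (sumBelow-cong k (λ i _ → countᵇ-seqs-without-1 k m (λ b → P (suc (suc i) ∷ b)))) ⟩
  sumBelow k (λ i → countᵇ (λ c → P (suc (suc i) ∷ map suc c)) (seqs k m))
    ≡⟨ countᵇ-seqs-suc (λ c → P (map suc c)) k m ⟨
  countᵇ (λ c → P (map suc c)) (seqs k (suc m))
    ∎
  where open ≡-Reasoning

countᵇ-seqs-bounded : ∀ k m (P : List ℕ → Bool) → (∀ b → length b ≡ m → T (P b) → All (_≤ k) b) →
                      countᵇ P (seqs (suc k) m) ≡ countᵇ P (seqs k m)
countᵇ-seqs-bounded k zero    P _       = refl
countᵇ-seqs-bounded k (suc m) P bounded = begin
  countᵇ P (seqs (suc k) (suc m))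
    ≡⟨ countᵇ-seqs-suc P (suc k) m ⟩
  sumBelow (suc k) (λ i → countᵇ (λ b → P (suc i ∷ b)) (seqs (suc k) m))
    ≡⟨ sumBelow-last k _ ⟩
  sumBelow k (λ i → countᵇ (λ b → P (suc i ∷ b)) (seqs (suc k) m))
    + countᵇ (λ b → P (suc k ∷ b)) (seqs (suc k) m)
    ≡⟨ cong₂ _+_ (sumBelow-cong k (λ i _ → countᵇ-seqs-bounded k m _
                   (λ b len → All.tail ∘ bounded (suc i ∷ b) (cong suc len))))
                 (trans (countᵇ-seqs-cong (suc k) m too-large) (countᵇ-none (seqs (suc k) m) (λ _ → refl))) ⟩
  sumBelow k (λ i → countᵇ (λ b → P (suc i ∷ b)) (seqs k m)) + 0
    ≡⟨ +-identityʳ _ ⟩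
  sumBelow k (λ i → countᵇ (λ b → P (suc i ∷ b)) (seqs k m))
    ≡⟨ countᵇ-seqs-suc P k m ⟨
  countᵇ P (seqs k (suc m))
    ∎
  where
  open ≡-Reasoning
  too-large : ∀ b → length b ≡ m → All (_≤ suc k) b → P (suc k ∷ b) ≡ false
  too-large b len _ with P (suc k ∷ b) in holds
  ... | false = refl
  ... | true  = ⊥-elim (<-irrefl refl (All.head (bounded (suc k ∷ b) (cong suc len) (subst T (sym holds) _))))

countᵇ-startingWith : ∀ (P : List ℕ → Bool) {n l} m → l < n →
  countᵇ P (filterᵇ (headIs (suc l)) (seqs n (suc m))) ≡ countᵇ (λ b → P (suc l ∷ b)) (seqs n m)
countᵇ-startingWith P {n} {l} m l<n = begin
  countᵇ P (filterᵇ (headIs (suc l)) (seqs n (suc m)))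
    ≡⟨ countᵇ-filterᵇ P (headIs (suc l)) (seqs n (suc m)) ⟩
  countᵇ (λ b → headIs (suc l) b ∧ P b) (seqs n (suc m))
    ≡⟨ countᵇ-seqs-suc _ n m ⟩
  sumBelow n (λ i → countᵇ (λ b → (i ≡ᵇ l) ∧ P (suc i ∷ b)) (seqs n m))
    ≡⟨ sumBelow-single l l<n (λ i i≢l →
         countᵇ-none (seqs n m) (λ b → cong (_∧ P (suc i ∷ b)) (≢⇒≡ᵇ-false i≢l))) ⟩
  countᵇ (λ b → (l ≡ᵇ l) ∧ P (suc l ∷ b)) (seqs n m)
    ≡⟨ countᵇ-cong (seqs n m) (λ b → cong (_∧ P (suc l ∷ b)) (≡ᵇ-refl l)) ⟩
  countᵇ (λ b → P (suc l ∷ b)) (seqs n m)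
    ∎
  where
  open ≡-Reasoning
  ≡ᵇ-refl : ∀ i → (i ≡ᵇ i) ≡ true
  ≡ᵇ-refl zero    = refl
  ≡ᵇ-refl (suc i) = ≡ᵇ-refl i
  ≢⇒≡ᵇ-false : ∀ {i j} → i ≢ j → (i ≡ᵇ j) ≡ false
  ≢⇒≡ᵇ-false {i} {j} i≢j = ¬-not (λ i≡ᵇj → i≢j (≡ᵇ⇒≡ i j (subst T (sym i≡ᵇj) _)))

-- What cars 2, ..., n see once car 1 has taken the last space (m = n - 1) or space 2 (k = n - 2).
lastTaken : ℕ → List Bool
lastTaken m = replicate m false ++ true ∷ []

secondTaken : ℕ → List Bool
secondTaken k = false ∷ true ∷ replicate k false

freeUpTo-replicate : ∀ j k → freeUpTo j (replicate k false) ≡ j ⊓ k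
freeUpTo-replicate zero    k       = refl
freeUpTo-replicate (suc j) zero    = refl
freeUpTo-replicate (suc j) (suc k) = cong suc (freeUpTo-replicate j k)

freeUpTo-lastTaken : ∀ j m → freeUpTo j (lastTaken m) ≡ j ⊓ m
freeUpTo-lastTaken zero    m       = refl
freeUpTo-lastTaken (suc j) zero    = freeUpTo-[] j
freeUpTo-lastTaken (suc j) (suc m) = cong suc (freeUpTo-lastTaken j m)

freeTotal-replicate : ∀ k → freeTotal (replicate k false) ≡ k
freeTotal-replicate zero    = refl
freeTotal-replicate (suc k) = cong suc (freeTotal-replicate k)

freeTotal-lastTaken : ∀ m → freeTotal (lastTaken m) ≡ m
freeTotal-lastTaken zero    = refl
freeTotal-lastTaken (suc m) = cong suc (freeTotal-lastTaken m)

parkFrom-last : ∀ m → parkFrom (suc m) 1 (replicate (suc m) false) ≡ (lastTaken m , true)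
parkFrom-last zero    = refl
parkFrom-last (suc m) rewrite parkFrom-suc (suc m) 1 (replicate (suc m) false) | parkFrom-last m = refl

failuresOn-parks : ∀ {a L L'} b → parkFrom a 1 L ≡ (L' , true) → failuresOn L (a ∷ b) ≡ failuresOn L' b
failuresOn-parks {a} {L} b parked with parkFrom a 1 L | parked
... | _ | refl = refl

suc-⊓-≤ : ∀ j m → suc j ⊓ m ≤ suc (j ⊓ m)
suc-⊓-≤ j m = ⊓-monoʳ-≤ (suc j) (n≤1+n m)

module _ {k b} (deficit : DeficitAtMost 0 (secondTaken k) b) where

  secondTaken⇒anyPrefers1 : 1 ≤ prefsUpTo 1 b
  secondTaken⇒anyPrefers1 = deficit 1

  secondTaken⇒lastTaken : DeficitAtMost 1 (lastTaken (suc k)) b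
  secondTaken⇒lastTaken zero          = z≤n
  secondTaken⇒lastTaken (suc zero)    = s≤s z≤n
  secondTaken⇒lastTaken (suc (suc j)) = s≤s (begin
    freeUpTo (suc j) (lastTaken k)          ≡⟨ freeUpTo-lastTaken (suc j) k ⟩
    suc j ⊓ k                               ≤⟨ suc-⊓-≤ j k ⟩
    suc (j ⊓ k)                             ≡⟨ cong suc (freeUpTo-replicate j k) ⟨
    freeUpTo (suc (suc j)) (secondTaken k)  ≤⟨ deficit (suc (suc j)) ⟩
    prefsUpTo (suc (suc j)) b               ∎)
    where open ≤-Reasoning

lastTaken⇒secondTaken : ∀ {k b} → length b ≡ suc k → All (_≤ suc (suc k)) b → 1 ≤ prefsUpTo 1 b →
                        DeficitAtMost 1 (lastTaken (suc k)) b → DeficitAtMost 0 (secondTaken k) b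
lastTaken⇒secondTaken _ _ _        _ zero       = z≤n
lastTaken⇒secondTaken _ _ prefers1 _ (suc zero) = prefers1
lastTaken⇒secondTaken {k} {b} len bounded prefers1 deficit (suc (suc j))
  rewrite freeUpTo-replicate j k with j <? k
... | yes j<k = begin
  suc (j ⊓ k)                       ≡⟨ cong suc (m≤n⇒m⊓n≡m (<⇒≤ j<k)) ⟩
  suc j                             ≡⟨ m≤n⇒m⊓n≡m j<k ⟨
  suc j ⊓ k                         ≡⟨ freeUpTo-lastTaken (suc j) k ⟨
  freeUpTo (suc j) (lastTaken k)    ≤⟨ ≤-pred (deficit (suc (suc j))) ⟩
  prefsUpTo (suc (suc j)) b         ∎
  where open ≤-Reasoning
... | no j≮k = begin
  suc (j ⊓ k)                       ≡⟨ cong suc (m≥n⇒m⊓n≡n (≮⇒≥ j≮k)) ⟩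
  suc k                             ≡⟨ len ⟨
  length b                          ≡⟨ prefsUpTo-bounded bounded (s≤s (s≤s (≮⇒≥ j≮k))) ⟨
  prefsUpTo (suc (suc j)) b         ∎
  where open ≤-Reasoning

lastTaken-map-suc⇐ : ∀ {m} c → DeficitAtMost 0 (lastTaken m) c → DeficitAtMost 1 (lastTaken m) (map suc c)
lastTaken-map-suc⇐ _ _ zero = z≤n
lastTaken-map-suc⇐ {m} c deficit (suc j) = begin
  freeUpTo (suc j) (lastTaken m)        ≡⟨ freeUpTo-lastTaken (suc j) m ⟩
  suc j ⊓ m                             ≤⟨ suc-⊓-≤ j m ⟩
  suc (j ⊓ m)                           ≡⟨ cong suc (freeUpTo-lastTaken j m) ⟨
  suc (freeUpTo j (lastTaken m))        ≤⟨ s≤s (deficit j) ⟩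
  suc (prefsUpTo j c)                   ≡⟨ cong suc (prefsUpTo-map-suc j c) ⟨
  suc (prefsUpTo (suc j) (map suc c))   ∎
  where open ≤-Reasoning

lastTaken-map-suc⇒ : ∀ {m} c → length c ≡ m → All (_≤ m) c →
                   DeficitAtMost 1 (lastTaken m) (map suc c) → DeficitAtMost 0 (lastTaken m) c
lastTaken-map-suc⇒ {m} c len bounded deficit j rewrite freeUpTo-lastTaken j m with j <? m
... | yes j<m = begin
  j ⊓ m                                 ≡⟨ m≤n⇒m⊓n≡m (<⇒≤ j<m) ⟩
  j                                     ≤⟨ ≤-pred (begin
    suc j                                 ≡⟨ m≤n⇒m⊓n≡m j<m ⟨
    suc j ⊓ m                             ≡⟨ freeUpTo-lastTaken (suc j) m ⟨
    freeUpTo (suc j) (lastTaken m)        ≤⟨ deficit (suc j) ⟩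
    suc (prefsUpTo (suc j) (map suc c))   ≡⟨ cong suc (prefsUpTo-map-suc j c) ⟩
    suc (prefsUpTo j c)                   ∎) ⟩
  prefsUpTo j c                         ∎
  where open ≤-Reasoning
... | no j≮m = begin
  j ⊓ m                                 ≡⟨ m≥n⇒m⊓n≡n (≮⇒≥ j≮m) ⟩
  m                                     ≡⟨ len ⟨
  length c                              ≡⟨ prefsUpTo-bounded bounded (≮⇒≥ j≮m) ⟨
  prefsUpTo j c                         ∎
  where open ≤-Reasoning

prefers1∧atMostOneFlaw≡parking-secondTaken : ∀ {k} b → length b ≡ suc k → All (_≤ suc (suc k)) b →
  (anyPrefers1 b ∧ (failuresOn (lastTaken (suc k)) b ≤ᵇ 1)) ≡ (failuresOn (secondTaken k) b ≤ᵇ 0)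
prefers1∧atMostOneFlaw≡parking-secondTaken {k} b len bounded = T-⇔⇒≡ (mk⇔ to from)
  where
  module D₁ = Equivalence (T-failures≤ᵇ⇔deficit (lastTaken (suc k)) b 1
                             (trans (freeTotal-lastTaken (suc k)) (sym len)))
  module D₂ = Equivalence (T-failures≤ᵇ⇔deficit (secondTaken k) b 0
                             (trans (cong suc (freeTotal-replicate k)) (sym len)))
  to : T (anyPrefers1 b ∧ (failuresOn (lastTaken (suc k)) b ≤ᵇ 1)) → T (failuresOn (secondTaken k) b ≤ᵇ 0)
  to prefers1∧atMostOne with Equivalence.to T-∧ prefers1∧atMostOne
  ... | prefers1 , atMostOne =
    D₂.from (lastTaken⇒secondTaken {k} {b} len bounded (≤ᵇ⇒≤ 1 _ prefers1) (D₁.to atMostOne))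
  from : T (failuresOn (secondTaken k) b ≤ᵇ 0) → T (anyPrefers1 b ∧ (failuresOn (lastTaken (suc k)) b ≤ᵇ 1))
  from noFlaw = Equivalence.from T-∧
    (≤⇒≤ᵇ (secondTaken⇒anyPrefers1 {k} {b} deficit) , D₁.from (secondTaken⇒lastTaken {k} {b} deficit))
    where
    deficit : DeficitAtMost 0 (secondTaken k) b
    deficit = D₂.to noFlaw

atMostOneFlaw-map-suc≡parking : ∀ {m} c → length c ≡ m → All (_≤ m) c →
  (failuresOn (lastTaken m) (map suc c) ≤ᵇ 1) ≡ (failuresOn (lastTaken m) c ≤ᵇ 0)
atMostOneFlaw-map-suc≡parking {m} c len bounded =
  T-⇔⇒≡ (mk⇔ (D₀.from ∘ lastTaken-map-suc⇒ {m} c len bounded ∘ D₁.to)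
              (D₁.from ∘ lastTaken-map-suc⇐ {m} c ∘ D₀.to))
  where
  free≡cars : freeTotal (lastTaken m) ≡ length c
  free≡cars = trans (freeTotal-lastTaken m) (sym len)
  module D₀ = Equivalence (T-failures≤ᵇ⇔deficit (lastTaken m) c 0 free≡cars)
  module D₁ = Equivalence (T-failures≤ᵇ⇔deficit (lastTaken m) (map suc c) 1
                             (trans free≡cars (sym (length-map suc c))))

parking-lastTaken⇒bounded : ∀ {m} c → length c ≡ m → T (failuresOn (lastTaken m) c ≤ᵇ 0) → All (_≤ m) c
parking-lastTaken⇒bounded {m} c len noFlaw = prefsUpTo≡length⇒bounded c (≤-antisym (prefsUpTo≤length m c)
  (subst (_≤ prefsUpTo m c) (trans (trans (freeUpTo-lastTaken m m) (⊓-idem m)) (sym len)) (deficit m)))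
  where
  deficit : DeficitAtMost 0 (lastTaken m) c
  deficit = Equivalence.to
    (T-failures≤ᵇ⇔deficit (lastTaken m) c 0 (trans (freeTotal-lastTaken m) (sym len))) noFlaw

≤ᵇ0∧≤ᵇ1 : ∀ x → ((x ≤ᵇ 0) ∧ (x ≤ᵇ 1)) ≡ (x ≤ᵇ 0)
≤ᵇ0∧≤ᵇ1 zero    = refl
≤ᵇ0∧≤ᵇ1 (suc x) = refl

≰ᵇ0∧≤ᵇ1 : ∀ x → (not (x ≤ᵇ 0) ∧ (x ≤ᵇ 1)) ≡ (x ≡ᵇ 1)
≰ᵇ0∧≤ᵇ1 zero          = refl
≰ᵇ0∧≤ᵇ1 (suc zero)    = refl
≰ᵇ0∧≤ᵇ1 (suc (suc x)) = refl

≤ᵇ0≡≡ᵇ0 : ∀ x → (x ≤ᵇ 0) ≡ (x ≡ᵇ 0)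
≤ᵇ0≡≡ᵇ0 zero    = refl
≤ᵇ0≡≡ᵇ0 (suc x) = refl

module _ (k : ℕ) where
  private
    m : ℕ
    m = suc k
    F₁ F₂ : List ℕ → ℕ
    F₁ = failuresOn (lastTaken m)
    F₂ = failuresOn (secondTaken k)
    count : (ℕ → Bool) → (List ℕ → ℕ) → ℕ
    count P F = countᵇ (λ b → P (F b)) (seqs (suc m) m)

  atMostOneFlaw-by-flaws : count (_≤ᵇ 1) F₁ ≡ count (_≤ᵇ 0) F₁ + count (_≡ᵇ 1) F₁
  atMostOneFlaw-by-flaws = trans (countᵇ-split (λ b → F₁ b ≤ᵇ 0) _ (seqs (suc m) m))
    (cong₂ _+_ (countᵇ-cong (seqs (suc m) m) (≤ᵇ0∧≤ᵇ1 ∘ F₁))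
               (countᵇ-cong (seqs (suc m) m) (≰ᵇ0∧≤ᵇ1 ∘ F₁)))

  atMostOneFlaw-by-prefers1 : count (_≤ᵇ 1) F₁ ≡ count (_≡ᵇ 0) F₂ + count (_≤ᵇ 0) F₁
  atMostOneFlaw-by-prefers1 = begin
    count (_≤ᵇ 1) F₁
      ≡⟨ countᵇ-split anyPrefers1 _ (seqs (suc m) m) ⟩
    countᵇ (λ b → anyPrefers1 b ∧ (F₁ b ≤ᵇ 1)) (seqs (suc m) m)
      + countᵇ (λ b → not (anyPrefers1 b) ∧ (F₁ b ≤ᵇ 1)) (seqs (suc m) m)
      ≡⟨ cong₂ _+_ (countᵇ-seqs-cong (suc m) m (λ b len bounded →
                      trans (prefers1∧atMostOneFlaw≡parking-secondTaken b len bounded) (≤ᵇ0≡≡ᵇ0 (F₂ b))))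
                   (countᵇ-seqs-without-1 m m _) ⟩
    count (_≡ᵇ 0) F₂ + countᵇ (λ c → F₁ (map suc c) ≤ᵇ 1) (seqs m m)
      ≡⟨ cong (count (_≡ᵇ 0) F₂ +_) (countᵇ-seqs-cong m m atMostOneFlaw-map-suc≡parking) ⟩
    count (_≡ᵇ 0) F₂ + countᵇ (λ c → F₁ c ≤ᵇ 0) (seqs m m)
      ≡⟨ cong (count (_≡ᵇ 0) F₂ +_) (countᵇ-seqs-bounded m m _ parking-lastTaken⇒bounded) ⟨
    count (_≡ᵇ 0) F₂ + count (_≤ᵇ 0) F₁
      ∎
    where open ≡-Reasoning

  oneFlaw-lastTaken≡parking-secondTaken : count (_≡ᵇ 1) F₁ ≡ count (_≡ᵇ 0) F₂
  oneFlaw-lastTaken≡parking-secondTaken = +-cancelˡ-≡ (count (_≤ᵇ 0) F₁) _ _ (begin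
    count (_≤ᵇ 0) F₁ + count (_≡ᵇ 1) F₁   ≡⟨ atMostOneFlaw-by-flaws ⟨
    count (_≤ᵇ 1) F₁                      ≡⟨ atMostOneFlaw-by-prefers1 ⟩
    count (_≡ᵇ 0) F₂ + count (_≤ᵇ 0) F₁   ≡⟨ +-comm (count (_≡ᵇ 0) F₂) _ ⟩
    count (_≤ᵇ 0) F₁ + count (_≡ᵇ 0) F₂   ∎)
    where open ≡-Reasoning

theorem6p5 : (n : ℕ) → 2 ≤ n → pFlaw n 1 n ≡ pPark n 2
theorem6p5 (suc zero)    (s≤s ())
theorem6p5 (suc (suc k)) _ = begin
  pFlaw n 1 n
    ≡⟨ countᵇ-startingWith (λ s → flaws n s ≡ᵇ 1) m ≤-refl ⟩
  countᵇ (λ b → flaws n (n ∷ b) ≡ᵇ 1) (seqs n m)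
    ≡⟨ countᵇ-cong (seqs n m)
         (λ b → cong (_≡ᵇ 1) (failuresOn-parks {n} {replicate n false} b (parkFrom-last m))) ⟩
  countᵇ (λ b → failuresOn (lastTaken m) b ≡ᵇ 1) (seqs n m)
    ≡⟨ oneFlaw-lastTaken≡parking-secondTaken k ⟩
  countᵇ (λ b → failuresOn (secondTaken k) b ≡ᵇ 0) (seqs n m)
    ≡⟨ countᵇ-startingWith (λ s → flaws n s ≡ᵇ 0) m (s≤s (s≤s z≤n)) ⟨
  pPark n 2
    ∎
  where
  open ≡-Reasoning
  m n : ℕ
  m = suc k
  n = suc m
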